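{- Let $G$ be a LUCS $\overline{P_3+K_2}$-free graph such that $N_G$ is an independent set, and regard $G$ as a partitioned graph with nonprobe set $N_G$ and probe set $V(G)\setminus N_G$. Then $G$ contains $H_5$ as a partitioned induced subgraph if and only if $G^\phi_B$ contains an induced $C_6$, for any bijection $\phi:V(G)\to\{0,\dots,|V(G)|-1\}$.
   Context: A graph is complete split if its vertex set can be partitioned into a clique $K$ and a maximum independent set $S$ with every vertex of $K$ adjacent to every vertex of $S$; $(K,S)$ is a complete split partition (unique when the graph is connected and $|S|\ge2$). $G$ is LUCS if for every vertex $v$, every connected component of $G[N(v)]$ is complete split. For a vertex $w$ and a component $C_w$ of $G[N(w)]$ with partition $(K_{C_w},S_{C_w})$, $C_w$ is non-special if $|S_{C_w}|\ge 2$. $F_G$ is the set of non-edges $uv$ with $u,v\in S_{C_w}$ for some $w$ and some component $C_w$; $N_G$ is the set of endpoints of pairs in $F_G$. $G^\phi_B$ is the bipartite graph with sides $N_G$ and $A_B$, where for each vertex $v$ and each non-special component $C_v$ of $G[N(v)]$ with $\phi(v)<\phi(x)$ for all $x\in K_{C_v}$ a new vertex is added to $A_B$ adjacent exactly to the vertices of $S_{C_v}$. A partitioned graph is a graph with a vertex partition into probes $P$ and an independent set of nonprobes $N$; a partitioned induced subgraph is an induced subgraph whose nonprobes are nonprobes of the host and whose probes are probes of the host, and isomorphism must preserve the partition. $H_5$ is the partitioned graph on nine vertices: three pairwise nonadjacent nonprobes $v_1,v_2,v_3$ and six probes forming three disjoint edges $u_{12}z_{12}$, $u_{23}z_{23}$,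 $u_{31}z_{31}$ (no other edges among probes), where $u_{ij}$ and $z_{ij}$ are each adjacent exactly to $v_i$ and $v_j$ among the nonprobes. -}

module Defs where

open import Data.Nat using (ℕ; zero; suc; _≤_; _≡ᵇ_)
open import Data.Nat.DivMod using (_%_)
open import Data.Bool using (Bool; true; false; _∧_; _∨_; not)
open import Data.Fin using (Fin; toℕ) renaming (_<_ to _<ᶠ_)
open import Data.Fin.Subset using (Subset; _∈_; _∉_; _⊆_; ∣_∣)
open import Data.List using (List; []; _∷_)
open import Data.Bool.ListAction using (any)
open import Data.Product using (Σ; ∃; ∃-syntax; _×_; _,_)
open import Data.Sum using (_⊎_)
open import Relation.Nullary using (¬_; Dec)
open import Relation.Binary.PropositionalEquality using (_≡_; _≢_)
open import Function.Bundles using (_⇔_)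
open import Function.Definitions using (Injective)

record SimpleGraph (n : ℕ) : Set₁ where
  field
    E       : Fin n → Fin n → Set
    E-sym   : ∀ {x y} → E x y → E y x
    E-irr   : ∀ {x} → ¬ E x x
    E-dec   : ∀ x y → Dec (E x y)

record Graph : Set₁ where
  field
    V : Set
    E : V → V → Set

edgeAdj : ∀ {k} → List (ℕ × ℕ) → Fin k → Fin k → Bool
edgeAdj es i j = any (λ { (a , b) →
  ((toℕ i ≡ᵇ a) ∧ (toℕ j ≡ᵇ b)) ∨ ((toℕ i ≡ᵇ b) ∧ (toℕ j ≡ᵇ a)) }) es

p3k2 : Fin 5 → Fin 5 → Bool
p3k2 = edgeAdj ((0 , 1) ∷ (1 , 2) ∷ (3 , 4) ∷ [])

coP3K2 : Fin 5 → Fin 5 → Bool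
coP3K2 i j = not (toℕ i ≡ᵇ toℕ j) ∧ not (p3k2 i j)

module _ {n : ℕ} (G : SimpleGraph n) where
  open SimpleGraph G

  InducedCopy : ∀ {k} → (Fin k → Fin k → Bool) → Set
  InducedCopy {k} H = Σ (Fin k → Fin n) λ f →
    Injective _≡_ _≡_ f × (∀ i j → E (f i) (f j) ⇔ (H i j ≡ true))

  CoP3K2Free : Set
  CoP3K2Free = ¬ InducedCopy coP3K2

  data Reach (C : Subset n) : Fin n → Fin n → Set where
    here : ∀ {x} → Reach C x x
    step : ∀ {x y z} → E x y → y ∈ C → Reach C y z → Reach C x z

  Connected : Subset n → Set
  Connected C = ∀ x y → x ∈ C → y ∈ C → Reach C x y

  -- C is (the vertex set of) a connected component of G[N(v)]
  IsComponent : Fin n → Subset n → Set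
  IsComponent v C =
    (∃[ x ] x ∈ C) ×
    (∀ x → x ∈ C → E v x) ×
    Connected C ×
    (∀ x y → x ∈ C → E v y → E x y → y ∈ C)

  Clique : Subset n → Set
  Clique K = ∀ x y → x ∈ K → y ∈ K → x ≢ y → E x y

  Independent : Subset n → Set
  Independent S = ∀ x y → x ∈ S → y ∈ S → ¬ E x y

  CSPartition : Subset n → Subset n → Subset n → Set
  CSPartition C K S =
    (∀ x → (x ∈ C → x ∈ K ⊎ x ∈ S) × (x ∈ K → x ∈ C) × (x ∈ S → x ∈ C)) ×
    (∀ x → x ∈ K → x ∉ S) ×
    Clique K ×
    Independent S ×
    (∀ T → T ⊆ C → Independent T → ∣ T ∣ ≤ ∣ S ∣) ×
    (∀ x y → x ∈ K → y ∈ S → E x y)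

  IsCompleteSplit : Subset n → Set
  IsCompleteSplit C = ∃[ K ] ∃[ S ] CSPartition C K S

  LUCS : Set
  LUCS = ∀ v C → IsComponent v C → IsCompleteSplit C

  InF : Fin n → Fin n → Set
  InF u w = u ≢ w × ¬ E u w ×
    (∃[ v ] ∃[ C ] ∃[ K ] ∃[ S ]
       IsComponent v C × CSPartition C K S × u ∈ S × w ∈ S)

  InNG : Fin n → Set
  InNG u = ∃[ w ] InF u w

  NGIndependent : Set
  NGIndependent = ∀ u w → InNG u → InNG w → ¬ E u w

  -- vertices: 0,1,2 = v1,v2,v3 (nonprobes);
  -- 3,4 = u12,z12 ; 5,6 = u23,z23 ; 7,8 = u31,z31 (probes)
  h5 : Fin 9 → Fin 9 → Bool
  h5 = edgeAdj ((3 , 4) ∷ (5 , 6) ∷ (7 , 8) ∷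
                (3 , 0) ∷ (3 , 1) ∷ (4 , 0) ∷ (4 , 1) ∷
                (5 , 1) ∷ (5 , 2) ∷ (6 , 1) ∷ (6 , 2) ∷
                (7 , 2) ∷ (7 , 0) ∷ (8 , 2) ∷ (8 , 0) ∷ [])

  h5Nonprobe : Fin 9 → Bool
  h5Nonprobe i = toℕ i Data.Nat.<ᵇ 3

  ContainsH5 : Set
  ContainsH5 = Σ (Fin 9 → Fin n) λ f →
    Injective _≡_ _≡_ f ×
    (∀ i j → E (f i) (f j) ⇔ (h5 i j ≡ true)) ×
    (∀ i → (h5Nonprobe i ≡ true → InNG (f i)) ×
           (h5Nonprobe i ≡ false → ¬ InNG (f i)))

  module _ (φ : Fin n → Fin n) where

    record NSide : Set where
      constructor nv
      field
        vert  : Fin n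
        .inNG : InNG vert

    -- vertices of A_B: one per pair (v , C_v) with C_v a non-special
    -- component of G[N(v)] and φ(v) < φ(x) for all x ∈ K_{C_v}
    record ASide : Set where
      constructor av
      field
        centre : Fin n
        comp   : Subset n
        .valid : IsComponent centre comp ×
                 (∃[ K ] ∃[ S ] CSPartition comp K S × 2 ≤ ∣ S ∣ ×
                    (∀ x → x ∈ K → φ centre <ᶠ φ x))

    ABAdj : NSide → ASide → Set
    ABAdj u a = ∃[ K ] ∃[ S ]
      CSPartition (ASide.comp a) K S × NSide.vert u ∈ S

    BEdge : NSide ⊎ ASide → NSide ⊎ ASide → Set
    BEdge (Data.Sum.inj₁ u) (Data.Sum.inj₂ a) = ABAdj u a
    BEdge (Data.Sum.inj₂ a) (Data.Sum.inj₁ u) = ABAdj u a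
    BEdge _ _ = Data.Empty.⊥
      where import Data.Empty

    GB : Graph
    GB = record { V = NSide ⊎ ASide ; E = BEdge }

cycAdj : Fin 6 → Fin 6 → Set
cycAdj i j = (toℕ j ≡ suc (toℕ i) % 6) ⊎ (toℕ i ≡ suc (toℕ j) % 6)

InducedC6 : Graph → Set
InducedC6 H = Σ (Fin 6 → V) λ f →
    Injective _≡_ _≡_ f × (∀ i j → E (f i) (f j) ⇔ cycAdj i j)
  where open Graph H

{-# OPTIONS --safe #-}
-- Both sides amount to a triangle x₁ x₂ x₃ of pairwise nonadjacent vertices in which every pair
-- is separated from the third vertex: in G by a wing (an edge whose ends are adjacent to both
-- vertices of the pair and to neither the third, i.e. the diamond v_i u_ij z_ij v_j of H₅), in
-- G^φ_B by a vertex of A_B adjacent to the pair only.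
--
-- The local fact behind everything: if x ≁ y are both adjacent to both ends of an edge pq, they
-- lie in the independent part S of one component of G[N(p)], so every neighbour of p adjacent
-- to x lies in its clique part and is adjacent to y ("x and y are local twins at p"). Freeness
-- of the complement of P₃ + K₂ extends this to every common neighbour of x and y.
--
-- From a wing on x₁ x₂, take a φ-minimal vertex m that misses x₃ and is an end of an edge over
-- x₁ x₂; the component of G[N(m)] containing x₁ x₂ is non-special, and by local twins each of its
-- clique vertices is another such m, hence φ-later: this gives the vertex of A_B. Conversely the
-- centre of a vertex of A_B and a clique vertex adjacent to x₁ span an edge over x₁ x₂, which
-- local twins show to miss x₃. Local twins also make the wings pairwise anticomplete, so the
-- nine vertices induce H₅, and the probes avoid N_G because N_G is independent.

module Submission where

open import Defs
open import Data.Nat as ℕ using (ℕ; zero; suc; _+_; _≤_; _<_)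
import Data.Nat.Properties as ℕ
open import Data.Nat.DivMod using (_%_)
open import Data.Bool as Bool using (Bool; true; false; if_then_else_)
open import Data.Fin as Fin using (Fin; toℕ) renaming (zero to fzero; suc to fsuc)
import Data.Fin.Properties as Fin
open import Data.Fin.Subset using (Subset; _∈_; _∉_; _⊆_; ∣_∣; ⁅_⁆; _∪_)
open import Data.Fin.Subset.Properties
  using (_∈?_; x∈p∪q⁺; x∈p∪q⁻; p⊆p∪q; x∈⁅x⁆; x∈⁅y⁆⇒x≡y; ∣⁅x⁆∣≡1; p⊂q⇒∣p∣<∣q∣; ∣p∣≤n)
open import Data.List as List using (List; []; _∷_; _++_; allFin; filter)
open import Data.List.Relation.Unary.All as All using (All; []; _∷_)
import Data.List.Relation.Unary.All.Properties as All
open import Data.List.Membership.Propositional.Properties using (∈-allFin; ∈-filter⁺)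
import Data.List.Extrema as Extrema
open import Data.Product as Product using (∃; ∃-syntax; Σ-syntax; _×_; _,_; proj₁; proj₂)
open import Data.Sum as Sum using (_⊎_; inj₁; inj₂)
open import Data.Empty using (⊥-elim)
open import Function using (_∘_; const)
open import Function.Bundles using (_⇔_; mk⇔; Equivalence)
open import Function.Definitions using (Injective; Bijective)
open import Relation.Nullary using (¬_; Dec; yes; no; does)
open import Relation.Nullary.Decidable
  using (True; False; toWitness; toWitnessFalse; from-yes; recompute; ¬?; _×-dec_; _⊎-dec_; _→-dec_)
open import Relation.Unary using (Decidable)
open import Relation.Binary.Definitions using (tri<; tri≈; tri>)
open import Relation.Binary.PropositionalEquality using (_≡_; _≢_; refl; sym; trans; subst)

pattern F0 = fzero
pattern F1 = fsuc F0
pattern F2 = fsuc F1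
pattern F3 = fsuc F2
pattern F4 = fsuc F3
pattern F5 = fsuc F4
pattern F6 = fsuc F5
pattern F7 = fsuc F6
pattern F8 = fsuc F7

minimiser : ∀ {n k} (f : Fin n → Fin k) {P : Fin n → Set} → Decidable P → ∃ P →
            ∃[ m ] P m × (∀ v → P v → f m Fin.≤ f v)
minimiser {n} {k} f P? (u , Pu) =
  m , argmin-all f Pu (All.all-filter P? (allFin n)) ,
  λ v Pv → All.lookup (f[argmin]≤f[xs] u xs) (∈-filter⁺ P? (∈-allFin v) Pv)
  where
    open Extrema (Fin.≤-totalOrder k)
    xs = filter P? (allFin n)
    m  = argmin f u xs

-- Realisations of finite pattern graphs

Agrees : {A : Set} → Dec A → Set → Set
Agrees d B = if does d then B else ¬ B

agrees⇒⇔ : {A B : Set} (d : Dec A) → Agrees d B → B ⇔ A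
agrees⇒⇔ (yes a) b  = mk⇔ (const a) (const b)
agrees⇒⇔ (no ¬a) ¬b = mk⇔ (⊥-elim ∘ ¬b) (⊥-elim ∘ ¬a)

upperPairs : ∀ k → List (Fin k × Fin k)
upperPairs zero    = []
upperPairs (suc k) =
  List.map (λ j → fzero , fsuc j) (allFin k) ++ List.map (Product.map fsuc fsuc) (upperPairs k)

lookup-upperPairs : ∀ {k} {P : Fin k × Fin k → Set} → All P (upperPairs k) →
                    ∀ {i j} → i Fin.< j → P (i , j)
lookup-upperPairs {suc k} ps {fzero} {fsuc j} _ = All.lookup (All.map⁻ (All.++⁻ˡ _ ps)) (∈-allFin j)
lookup-upperPairs {suc k} ps {fsuc i} {fsuc j} i<j =
  lookup-upperPairs (All.map⁻ (All.++⁻ʳ _ ps)) (ℕ.s<s⁻¹ i<j)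

module Pattern {k : ℕ} (H : SimpleGraph k) where
  open SimpleGraph H

  SameNeighbours : Fin k → Fin k → Set
  SameNeighbours i j = ∀ l → (E i l → E j l) × (E j l → E i l)

  sameNeighbours? : ∀ i j → Dec (SameNeighbours i j)
  sameNeighbours? i j = Fin.all? λ l → (E-dec i l →-dec E-dec j l) ×-dec (E-dec j l →-dec E-dec i l)

  TwinFree : Set
  TwinFree = ∀ i j → SameNeighbours i j → i ≡ j

  twinFree? : Dec TwinFree
  twinFree? = Fin.all? λ i → Fin.all? λ j → sameNeighbours? i j →-dec i Fin.≟ j

open Pattern using (SameNeighbours; TwinFree)

module _ {V : Set} (R : V → V → Set) {k : ℕ} (H : SimpleGraph k) where
  open SimpleGraph H renaming (E to Adj)

  Realises : (Fin k → V) → Set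
  Realises f = ∀ i j → R (f i) (f j) ⇔ Adj i j

  module _ {f : Fin k → V} (realises : Realises f) where

    realised-edge : ∀ i j → {True (E-dec i j)} → R (f i) (f j)
    realised-edge i j {a} = Equivalence.from (realises i j) (toWitness a)

    realised-non-edge : ∀ i j → {False (E-dec i j)} → ¬ R (f i) (f j)
    realised-non-edge i j {¬a} = toWitnessFalse ¬a ∘ Equivalence.to (realises i j)

    realises⇒sameNeighbours : ∀ {i j} → f i ≡ f j → SameNeighbours H i j
    realises⇒sameNeighbours {i} {j} fi≡fj l =
      Equivalence.to (realises j l) ∘ subst (λ v → R v (f l)) fi≡fj ∘ Equivalence.from (realises i l) ,
      Equivalence.to (realises i l) ∘ subst (λ v → R v (f l)) (sym fi≡fj) ∘ Equivalence.from (realises j l)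

    realises⇒injective : TwinFree H → Injective _≡_ _≡_ f
    realises⇒injective twinFree fi≡fj = twinFree _ _ (realises⇒sameNeighbours fi≡fj)

  -- One fact per pair i < j, in lexicographic order: the edge or non-edge that H prescribes.
  UpperFacts : (Fin k → V) → Set
  UpperFacts f = All (λ (i , j) → Agrees (E-dec i j) (R (f i) (f j))) (upperPairs k)

  realises-from-upperFacts : (∀ {u v} → R u v → R v u) → (∀ {v} → ¬ R v v) →
                             ∀ f → UpperFacts f → Realises f
  realises-from-upperFacts R-sym R-irr f facts i j with Fin.<-cmp i j
  ... | tri< i<j _ _ = agrees⇒⇔ (E-dec i j) (lookup-upperPairs facts i<j)
  ... | tri≈ _ refl _ = mk⇔ (⊥-elim ∘ R-irr) (⊥-elim ∘ E-irr)
  ... | tri> _ _ j<i =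
    let fact = agrees⇒⇔ (E-dec j i) (lookup-upperPairs facts j<i)
    in mk⇔ (E-sym ∘ Equivalence.to fact ∘ R-sym) (R-sym ∘ Equivalence.from fact ∘ E-sym)

boolPattern : ∀ {k} (H : Fin k → Fin k → Bool) →
              (∀ i j → H i j ≡ H j i) → (∀ i → H i i ≡ false) → SimpleGraph k
boolPattern H symmetric irreflexive = record
  { E     = λ i j → H i j ≡ true
  ; E-sym = λ {i} {j} → trans (symmetric j i)
  ; E-irr = λ {i} Hii → case-false (trans (sym (irreflexive i)) Hii)
  ; E-dec = λ i j → H i j Bool.≟ true
  }
  where
    case-false : false ≢ true
    case-false ()

symmetric? : ∀ {k} (H : Fin k → Fin k → Bool) → Dec (∀ i j → H i j ≡ H j i)
symmetric? H = Fin.all? λ i → Fin.all? λ j → H i j Bool.≟ H j i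

irreflexive? : ∀ {k} (H : Fin k → Fin k → Bool) → Dec (∀ i → H i i ≡ false)
irreflexive? H = Fin.all? λ i → H i i Bool.≟ false

coP3K2Pattern : SimpleGraph 5
coP3K2Pattern = boolPattern coP3K2 (from-yes (symmetric? coP3K2)) (from-yes (irreflexive? coP3K2))

coP3K2-twins : ∀ i j → SameNeighbours coP3K2Pattern i j →
               i ≡ j ⊎ (i ≡ F3 × j ≡ F4) ⊎ (i ≡ F4 × j ≡ F3)
coP3K2-twins = from-yes (Fin.all? λ i → Fin.all? λ j →
  Pattern.sameNeighbours? coP3K2Pattern i j →-dec
    (i Fin.≟ j ⊎-dec (i Fin.≟ F3 ×-dec j Fin.≟ F4) ⊎-dec (i Fin.≟ F4 ×-dec j Fin.≟ F3)))

cycAdj? : ∀ i j → Dec (cycAdj i j)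
cycAdj? i j = (toℕ j ℕ.≟ suc (toℕ i) % 6) ⊎-dec (toℕ i ℕ.≟ suc (toℕ j) % 6)

cyclePattern : SimpleGraph 6
cyclePattern = record
  { E     = cycAdj
  ; E-sym = Sum.swap
  ; E-irr = λ {i} → from-yes (Fin.all? λ i → ¬? (cycAdj? i i)) i
  ; E-dec = cycAdj?
  }

cycle-twinFree : TwinFree cyclePattern
cycle-twinFree = from-yes (Pattern.twinFree? cyclePattern)

record Triangle {X : Set} (Sep : X → X → X → Set) : Set where
  field
    x₁ x₂ x₃ : X
    sep₁₂ : Sep x₁ x₂ x₃
    sep₂₃ : Sep x₂ x₃ x₁
    sep₃₁ : Sep x₃ x₁ x₂

module _ {X : Set} {Sep : X → X → X → Set} where

  rotate : Triangle Sep → Triangle Sep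
  rotate T = record { x₁ = x₂ ; x₂ = x₃ ; x₃ = x₁ ; sep₁₂ = sep₂₃ ; sep₂₃ = sep₃₁ ; sep₃₁ = sep₁₂ }
    where open Triangle T

  -- Well typed because rotating three times is the identity up to record η.
  mapTriangle : {Y : Set} {Sep′ : Y → Y → Y → Set} (g : Triangle Sep → Y) →
                (∀ T → Sep′ (g T) (g (rotate T)) (g (rotate (rotate T)))) →
                Triangle Sep → Triangle Sep′
  mapTriangle g s T = record
    { x₁ = g T ; x₂ = g (rotate T) ; x₃ = g (rotate (rotate T))
    ; sep₁₂ = s T ; sep₂₃ = s (rotate T) ; sep₃₁ = s (rotate (rotate T)) }

-- Components of neighbourhoods

module Components {n : ℕ} (G : SimpleGraph n) where
  open SimpleGraph G

  private variable
    v w x y z : Fin n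
    C D K S : Subset n

  NonEdge : Fin n → Fin n → Set
  NonEdge x y = x ≢ y × ¬ E x y

  NonEdge-sym : NonEdge x y → NonEdge y x
  NonEdge-sym (x≢y , x≁y) = x≢y ∘ sym , x≁y ∘ E-sym

  Reach-trans : Reach G C x y → Reach G C y z → Reach G C x z
  Reach-trans here           r = r
  Reach-trans (step e y∈C r) r′ = step e y∈C (Reach-trans r r′)

  Reach-sym : x ∈ C → Reach G C x y → Reach G C y x
  Reach-sym x∈C here           = here
  Reach-sym x∈C (step e y∈C r) = Reach-trans (Reach-sym y∈C r) (step (E-sym e) x∈C here)

  Reach-mono : C ⊆ D → Reach G C x y → Reach G D x y
  Reach-mono C⊆D here           = here
  Reach-mono C⊆D (step e y∈C r) = step e (C⊆D y∈C) (Reach-mono C⊆D r)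

  Reach⇒step : x ≢ y → Reach G C x y → ∃[ t ] t ∈ C × E x t
  Reach⇒step x≢y here           = ⊥-elim (x≢y refl)
  Reach⇒step x≢y (step e t∈C _) = _ , t∈C , e

  record Rooted (v x : Fin n) (S : Subset n) : Set where
    field
      x∈S   : x ∈ S
      S⊆N   : ∀ y → y ∈ S → E v y
      reach : ∀ y → y ∈ S → Reach G S x y

  Frontier : Fin n → Subset n → Fin n → Set
  Frontier v S z = z ∉ S × E v z × ∃[ s ] s ∈ S × E s z

  frontier? : ∀ v S z → Dec (Frontier v S z)
  frontier? v S z =
    ¬? (z ∈? S) ×-dec E-dec v z ×-dec Fin.any? (λ s → (s ∈? S) ×-dec E-dec s z)

  closed⇒component : Rooted v x S → ¬ ∃ (Frontier v S) → IsComponent G v S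
  closed⇒component {v} {x} {S} r closed = (x , x∈S) , S⊆N , connected , shut
    where
      open Rooted r
      connected : Connected G S
      connected a b a∈S b∈S = Reach-trans (Reach-sym x∈S (reach a a∈S)) (reach b b∈S)
      shut : ∀ a y → a ∈ S → E v y → E a y → y ∈ S
      shut a y a∈S v~y a~y with y ∈? S
      ... | yes y∈S = y∈S
      ... | no  y∉S = ⊥-elim (closed (y , y∉S , v~y , a , a∈S , a~y))

  extend : Rooted v x S → Frontier v S z → Rooted v x (S ∪ ⁅ z ⁆)
  extend {v} {x} {S} {z} r (_ , v~z , s , s∈S , s~z) = record
    { x∈S = S⊆S′ x∈S ; S⊆N = S′⊆N ; reach = reach′ }
    where
      open Rooted r
      S⊆S′ : S ⊆ S ∪ ⁅ z ⁆
      S⊆S′ = p⊆p∪q ⁅ z ⁆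
      z∈S′ : z ∈ S ∪ ⁅ z ⁆
      z∈S′ = x∈p∪q⁺ (inj₂ (x∈⁅x⁆ z))
      S′⊆N : ∀ y → y ∈ S ∪ ⁅ z ⁆ → E v y
      S′⊆N y y∈S′ with x∈p∪q⁻ S ⁅ z ⁆ y∈S′
      ... | inj₁ y∈S = S⊆N y y∈S
      ... | inj₂ y∈z rewrite x∈⁅y⁆⇒x≡y z y∈z = v~z
      reach′ : ∀ y → y ∈ S ∪ ⁅ z ⁆ → Reach G (S ∪ ⁅ z ⁆) x y
      reach′ y y∈S′ with x∈p∪q⁻ S ⁅ z ⁆ y∈S′
      ... | inj₁ y∈S = Reach-mono S⊆S′ (reach y y∈S)
      ... | inj₂ y∈z rewrite x∈⁅y⁆⇒x≡y z y∈z =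
        Reach-trans (Reach-mono S⊆S′ (reach s s∈S)) (step s~z z∈S′ here)

  ∣S∣<∣S∪⁅z⁆∣ : z ∉ S → ∣ S ∣ < ∣ S ∪ ⁅ z ⁆ ∣
  ∣S∣<∣S∪⁅z⁆∣ {z} {S} z∉S = p⊂q⇒∣p∣<∣q∣ (p⊆p∪q ⁅ z ⁆ , z , x∈p∪q⁺ (inj₂ (x∈⁅x⁆ z)) , z∉S)

  grow : ∀ k → Rooted v x S → n ≤ ∣ S ∣ + k → ∃[ C ] IsComponent G v C × x ∈ C
  grow {v} {x} {S} k r bound with Fin.any? (frontier? v S)
  ... | no closed = S , closed⇒component r closed , Rooted.x∈S r
  grow {S = S} zero r bound | yes (z , z∉S , _) =
    ⊥-elim (ℕ.<-irrefl refl (ℕ.<-≤-trans (∣S∣<∣S∪⁅z⁆∣ z∉S)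
      (ℕ.≤-trans (∣p∣≤n (S ∪ ⁅ z ⁆)) (ℕ.≤-trans bound (ℕ.≤-reflexive (ℕ.+-identityʳ ∣ S ∣))))))
  grow {S = S} (suc k) r bound | yes (z , fz@(z∉S , _)) =
    grow k (extend r fz)
      (ℕ.≤-trans bound (ℕ.≤-trans (ℕ.≤-reflexive (ℕ.+-suc ∣ S ∣ k)) (ℕ.+-monoˡ-≤ k (∣S∣<∣S∪⁅z⁆∣ z∉S))))

  component-containing : E v x → ∃[ C ] IsComponent G v C × x ∈ C
  component-containing {v} {x} v~x = grow n singleton (ℕ.m≤n+m n _)
    where
      singleton : Rooted v x ⁅ x ⁆
      singleton = record
        { x∈S   = x∈⁅x⁆ x
        ; S⊆N   = λ y y∈x → subst (E v) (sym (x∈⁅y⁆⇒x≡y x y∈x)) v~x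
        ; reach = λ y y∈x → subst (Reach G ⁅ x ⁆ x) (sym (x∈⁅y⁆⇒x≡y x y∈x)) here
        }

  module _ (P : CSPartition G C K S) where
    private
      cover   = proj₁ P
      clique  = proj₁ (proj₂ (proj₂ P))
      indep   = proj₁ (proj₂ (proj₂ (proj₂ P)))
      complete = proj₂ (proj₂ (proj₂ (proj₂ (proj₂ P))))

    S⊆C : x ∈ S → x ∈ C
    S⊆C {x} = proj₂ (proj₂ (cover x))

    K⊆C : x ∈ K → x ∈ C
    K⊆C {x} = proj₁ (proj₂ (cover x))

    K~S : x ∈ K → y ∈ S → E x y
    K~S = complete _ _

    ∈K-of-adjacent : y ∈ C → x ∈ S → E x y → y ∈ K
    ∈K-of-adjacent {y} {x} y∈C x∈S x~y with proj₁ (cover y) y∈C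
    ... | inj₁ y∈K = y∈K
    ... | inj₂ y∈S = ⊥-elim (indep x y x∈S y∈S x~y)

    ∈S-of-nonadjacent : y ∈ C → x ∈ S → ¬ E y x → y ∈ S
    ∈S-of-nonadjacent {y} {x} y∈C x∈S y≁x with proj₁ (cover y) y∈C
    ... | inj₁ y∈K = ⊥-elim (y≁x (K~S y∈K x∈S))
    ... | inj₂ y∈S = y∈S

    ∈S-of-nonEdge : x ∈ C → y ∈ C → NonEdge x y → x ∈ S
    ∈S-of-nonEdge {x} {y} x∈C y∈C (x≢y , x≁y) with proj₁ (cover x) x∈C | proj₁ (cover y) y∈C
    ... | inj₂ x∈S | _        = x∈S
    ... | inj₁ x∈K | inj₁ y∈K = ⊥-elim (x≁y (clique x y x∈K y∈K x≢y))
    ... | inj₁ x∈K | inj₂ y∈S = ⊥-elim (x≁y (K~S x∈K y∈S))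

  two≤∣S∣ : x ∈ S → y ∈ S → x ≢ y → 2 ≤ ∣ S ∣
  two≤∣S∣ {x} {S} {y} x∈S y∈S x≢y =
    subst (_< ∣ S ∣) (∣⁅x⁆∣≡1 x) (p⊂q⇒∣p∣<∣q∣ (⁅x⁆⊆S , y , y∈S , x≢y ∘ sym ∘ x∈⁅y⁆⇒x≡y x))
    where
      ⁅x⁆⊆S : ⁅ x ⁆ ⊆ S
      ⁅x⁆⊆S z∈x = subst (_∈ S) (sym (x∈⁅y⁆⇒x≡y x z∈x)) x∈S

  component-⊆N : IsComponent G v C → x ∈ C → E v x
  component-⊆N (_ , ⊆N , _) = ⊆N _

  component-connected : IsComponent G v C → x ∈ C → y ∈ C → Reach G C x y
  component-connected (_ , _ , connected , _) = connected _ _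

  component-closed : IsComponent G v C → x ∈ C → E v y → E x y → y ∈ C
  component-closed (_ , _ , _ , closed) = closed _ _

-- Local twins

module _ {n : ℕ} (G : SimpleGraph n) where
  open SimpleGraph G
  open Components G

  private variable
    w x y : Fin n

  record EdgeOver (x y : Fin n) : Set where
    field
      p q : Fin n
      p~q : E p q
      p~x : E p x
      p~y : E p y
      q~x : E q x
      q~y : E q y

  swap : EdgeOver x y → EdgeOver y x
  swap e = record { p = p ; q = q ; p~q = p~q ; p~x = p~y ; p~y = p~x ; q~x = q~y ; q~y = q~x }
    where open EdgeOver e

  record StableAt (w x y : Fin n) : Set where
    field
      C K S     : Subset n
      component : IsComponent G w C
      partition : CSPartition G C K S
      x∈S       : x ∈ S
      y∈S       : y ∈ S

  LocalTwins : Fin n → Fin n → Fin n → Set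
  LocalTwins w x y = ∀ {b} → E w b → E b x → E b y

  module _ (lucs : LUCS G) where

    stableAt : (e : EdgeOver x y) → NonEdge x y → StableAt (EdgeOver.p e) x y
    stableAt {x} {y} e xy with component-containing (EdgeOver.p~q e)
    ... | C , comp , q∈C with lucs _ C comp
    ... | K , S , P = record
      { C = C ; K = K ; S = S
      ; component = comp
      ; partition = P
      ; x∈S = ∈S-of-nonEdge P x∈C y∈C xy
      ; y∈S = ∈S-of-nonEdge P y∈C x∈C (NonEdge-sym xy)
      }
      where
        open EdgeOver e
        x∈C = component-closed comp q∈C p~x q~x
        y∈C = component-closed comp q∈C p~y q~y

    stableAt⇒localTwins : StableAt w x y → LocalTwins w x y
    stableAt⇒localTwins s w~b b~x = K~S partition b∈K y∈S
      where
        open StableAt s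
        b∈C = component-closed component (S⊆C partition x∈S) w~b (E-sym b~x)
        b∈K = ∈K-of-adjacent partition b∈C x∈S (E-sym b~x)

    localTwins-at : (e : EdgeOver x y) → NonEdge x y → LocalTwins (EdgeOver.p e) x y
    localTwins-at e xy = stableAt⇒localTwins (stableAt e xy)

    inF : EdgeOver x y → NonEdge x y → InF G x y
    inF e xy@(x≢y , x≁y) = x≢y , x≁y , EdgeOver.p e , C , K , S , component , partition , x∈S , y∈S
      where open StableAt (stableAt e xy)

    module _ (cof : CoP3K2Free G) where

      -- f sends 0, 1, 2 to the path p – w – q of P₃ + K₂ and 3, 4 to its edge x y.
      coP3K2-copy : ∀ {p q} → ¬ E p w → ¬ E w q → E p q → E p x → E p y → E w x → E w y →
                    E q x → E q y → NonEdge x y → InducedCopy G coP3K2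
      coP3K2-copy {w} {x} {y} {p} {q} p≁w w≁q p~q p~x p~y w~x w~y q~x q~y (x≢y , x≁y) =
        f , injective , realises
        where
          f : Fin 5 → Fin n
          f F0 = p
          f F1 = w
          f F2 = q
          f F3 = x
          f F4 = y
          realises : Realises E coP3K2Pattern f
          realises = realises-from-upperFacts E coP3K2Pattern E-sym E-irr f
            ( p≁w ∷ p~q ∷ p~x ∷ p~y
            ∷ w≁q ∷ w~x ∷ w~y
            ∷ q~x ∷ q~y
            ∷ x≁y ∷ [])
          injective : Injective _≡_ _≡_ f
          injective {i} {j} fi≡fj with coP3K2-twins i j (realises⇒sameNeighbours E coP3K2Pattern realises fi≡fj)
          ... | inj₁ i≡j                 = i≡j
          ... | inj₂ (inj₁ (refl , refl)) = ⊥-elim (x≢y fi≡fj)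
          ... | inj₂ (inj₂ (refl , refl)) = ⊥-elim (x≢y (sym fi≡fj))

      -- If w is adjacent to an end of the edge, that end and w form an edge over x y;
      -- otherwise w, p, q, x, y induce the complement of P₃ + K₂.
      localTwins : EdgeOver x y → NonEdge x y → E w x → E w y → LocalTwins w x y
      localTwins {x} {y} {w} e xy w~x w~y = twins (E-dec w p) (E-dec w q)
        where
          open EdgeOver e
          twins : Dec (E w p) → Dec (E w q) → LocalTwins w x y
          twins (yes w~p) _ = localTwins-at (record
            { p = w ; q = p ; p~q = w~p ; p~x = w~x ; p~y = w~y ; q~x = p~x ; q~y = p~y }) xy
          twins (no _) (yes w~q) = localTwins-at (record
            { p = w ; q = q ; p~q = w~q ; p~x = w~x ; p~y = w~y ; q~x = q~x ; q~y = q~y }) xy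
          twins (no w≁p) (no w≁q) =
            ⊥-elim (cof (coP3K2-copy (w≁p ∘ E-sym) w≁q p~q p~x p~y w~x w~y q~x q~y xy))

  -- H₅ as a triangle of wings

  -- x, y, p, q play v_i, v_j, u_ij, z_ij of H₅ and z is the third nonprobe.
  record Wing (x y z : Fin n) : Set where
    field
      x≁y : ¬ E x y
      p q : Fin n
      p~q : E p q
      p~x : E p x
      p~y : E p y
      q~x : E q x
      q~y : E q y
      p≁z : ¬ E p z
      q≁z : ¬ E q z

    edge : EdgeOver x y
    edge = record { p = p ; q = q ; p~q = p~q ; p~x = p~x ; p~y = p~y ; q~x = q~x ; q~y = q~y }

    x≢z : x ≢ z
    x≢z refl = p≁z p~x

    y≢z : y ≢ z
    y≢z refl = p≁z p~y

  flip : ∀ {z} → Wing x y z → Wing x y z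
  flip ω = record
    { x≁y = x≁y ; p = q ; q = p ; p~q = E-sym p~q
    ; p~x = q~x ; p~y = q~y ; q~x = p~x ; q~y = p~y ; p≁z = q≁z ; q≁z = p≁z }
    where open Wing ω

  WingEnd : Fin n → Fin n → Fin n → Fin n → Set
  WingEnd x y z v = E v x × E v y × ¬ E v z × ∃[ b ] E v b × E b x × E b y

  wingEnd? : ∀ x y z → Decidable (WingEnd x y z)
  wingEnd? x y z v = E-dec v x ×-dec E-dec v y ×-dec ¬? (E-dec v z) ×-dec
                     Fin.any? (λ b → E-dec v b ×-dec E-dec b x ×-dec E-dec b y)

  nonEdge₁₂ : (T : Triangle Wing) → NonEdge (Triangle.x₁ T) (Triangle.x₂ T)
  nonEdge₁₂ T = Wing.y≢z (Triangle.sep₃₁ T) , Wing.x≁y (Triangle.sep₁₂ T)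

  nonEdge₁₃ : (T : Triangle Wing) → NonEdge (Triangle.x₁ T) (Triangle.x₃ T)
  nonEdge₁₃ T = NonEdge-sym (nonEdge₁₂ (rotate (rotate T)))

  h5Pattern : SimpleGraph 9
  h5Pattern = boolPattern (h5 G) (from-yes (symmetric? (h5 G))) (from-yes (irreflexive? (h5 G)))

  h5-twinFree : TwinFree h5Pattern
  h5-twinFree = from-yes (Pattern.twinFree? h5Pattern)

  triangle-of-H5 : ContainsH5 G → Triangle Wing
  triangle-of-H5 (f , _ , realises , _) = record
    { x₁ = f F0 ; x₂ = f F1 ; x₃ = f F2
    ; sep₁₂ = record
      { x≁y = nonadj F0 F1 ; p = f F3 ; q = f F4 ; p~q = adj F3 F4
      ; p~x = adj F3 F0 ; p~y = adj F3 F1 ; q~x = adj F4 F0 ; q~y = adj F4 F1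
      ; p≁z = nonadj F3 F2 ; q≁z = nonadj F4 F2 }
    ; sep₂₃ = record
      { x≁y = nonadj F1 F2 ; p = f F5 ; q = f F6 ; p~q = adj F5 F6
      ; p~x = adj F5 F1 ; p~y = adj F5 F2 ; q~x = adj F6 F1 ; q~y = adj F6 F2
      ; p≁z = nonadj F5 F0 ; q≁z = nonadj F6 F0 }
    ; sep₃₁ = record
      { x≁y = nonadj F2 F0 ; p = f F7 ; q = f F8 ; p~q = adj F7 F8
      ; p~x = adj F7 F2 ; p~y = adj F7 F0 ; q~x = adj F8 F2 ; q~y = adj F8 F0
      ; p≁z = nonadj F7 F1 ; q≁z = nonadj F8 F1 }
    }
    where
      adj    = realised-edge E h5Pattern realises
      nonadj = realised-non-edge E h5Pattern realises

  h5Map : Triangle Wing → Fin 9 → Fin n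
  h5Map T F0 = Triangle.x₁ T
  h5Map T F1 = Triangle.x₂ T
  h5Map T F2 = Triangle.x₃ T
  h5Map T F3 = Wing.p (Triangle.sep₁₂ T)
  h5Map T F4 = Wing.q (Triangle.sep₁₂ T)
  h5Map T F5 = Wing.p (Triangle.sep₂₃ T)
  h5Map T F6 = Wing.q (Triangle.sep₂₃ T)
  h5Map T F7 = Wing.p (Triangle.sep₃₁ T)
  h5Map T F8 = Wing.q (Triangle.sep₃₁ T)

  module _ (lucs : LUCS G) where

    inNG₁ : (T : Triangle Wing) → InNG G (Triangle.x₁ T)
    inNG₁ T = Triangle.x₂ T , inF lucs (Wing.edge (Triangle.sep₁₂ T)) (nonEdge₁₂ T)

    -- Ends of ω are adjacent to y, ends of ω′ are adjacent to y but not to x,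
    -- while y and x are local twins at every end of ω.
    apart : ∀ {z} (ω : Wing x y z) (ω′ : Wing y z x) → ¬ E (Wing.p ω) (Wing.p ω′)
    apart ω ω′ s~t = Wing.p≁z ω′
      (localTwins-at lucs (swap (Wing.edge ω)) (Wing.x≢z ω′ , Wing.x≁y ω ∘ E-sym) s~t (Wing.p~x ω′))

    h5Map-realises : (T : Triangle Wing) → Realises E h5Pattern (h5Map T)
    h5Map-realises T = realises-from-upperFacts E h5Pattern E-sym E-irr (h5Map T)
      ( x≁y sep₁₂ ∷ x≁y sep₃₁ ∘ E-sym ∷ E-sym (p~x sep₁₂) ∷ E-sym (q~x sep₁₂)
      ∷ p≁z sep₂₃ ∘ E-sym ∷ q≁z sep₂₃ ∘ E-sym ∷ E-sym (p~y sep₃₁) ∷ E-sym (q~y sep₃₁)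
      ∷ x≁y sep₂₃ ∷ E-sym (p~y sep₁₂) ∷ E-sym (q~y sep₁₂) ∷ E-sym (p~x sep₂₃) ∷ E-sym (q~x sep₂₃)
      ∷ p≁z sep₃₁ ∘ E-sym ∷ q≁z sep₃₁ ∘ E-sym
      ∷ p≁z sep₁₂ ∘ E-sym ∷ q≁z sep₁₂ ∘ E-sym ∷ E-sym (p~y sep₂₃) ∷ E-sym (q~y sep₂₃)
      ∷ E-sym (p~x sep₃₁) ∷ E-sym (q~x sep₃₁)
      ∷ p~q sep₁₂ ∷ apart sep₁₂ sep₂₃ ∷ apart sep₁₂ (flip sep₂₃)
      ∷ apart sep₃₁ sep₁₂ ∘ E-sym ∷ apart (flip sep₃₁) sep₁₂ ∘ E-sym
      ∷ apart (flip sep₁₂) sep₂₃ ∷ apart (flip sep₁₂) (flip sep₂₃)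
      ∷ apart sep₃₁ (flip sep₁₂) ∘ E-sym ∷ apart (flip sep₃₁) (flip sep₁₂) ∘ E-sym
      ∷ p~q sep₂₃ ∷ apart sep₂₃ sep₃₁ ∷ apart sep₂₃ (flip sep₃₁)
      ∷ apart (flip sep₂₃) sep₃₁ ∷ apart (flip sep₂₃) (flip sep₃₁)
      ∷ p~q sep₃₁ ∷ [])
      where
        open Triangle T
        open Wing

    module _ (ngi : NGIndependent G) where

      ∉NG-of-adjacent : ∀ {t x} → E t x → InNG G x → ¬ InNG G t
      ∉NG-of-adjacent t~x x∈N t∈N = ngi _ _ t∈N x∈N t~x

      h5Map-probes : (T : Triangle Wing) → ∀ i →
                     (h5Nonprobe G i ≡ true → InNG G (h5Map T i)) × (h5Nonprobe G i ≡ false → ¬ InNG G (h5Map T i))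
      h5Map-probes T F0 = const (inNG₁ T) , λ ()
      h5Map-probes T F1 = const (inNG₁ (rotate T)) , λ ()
      h5Map-probes T F2 = const (inNG₁ (rotate (rotate T))) , λ ()
      h5Map-probes T F3 = (λ ()) , const (∉NG-of-adjacent (Wing.p~x (Triangle.sep₁₂ T)) (inNG₁ T))
      h5Map-probes T F4 = (λ ()) , const (∉NG-of-adjacent (Wing.q~x (Triangle.sep₁₂ T)) (inNG₁ T))
      h5Map-probes T F5 = (λ ()) , const (∉NG-of-adjacent (Wing.p~x (Triangle.sep₂₃ T)) (inNG₁ (rotate T)))
      h5Map-probes T F6 = (λ ()) , const (∉NG-of-adjacent (Wing.q~x (Triangle.sep₂₃ T)) (inNG₁ (rotate T)))
      h5Map-probes T F7 = (λ ()) , const (∉NG-of-adjacent (Wing.p~x (Triangle.sep₃₁ T)) (inNG₁ (rotate (rotate T))))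
      h5Map-probes T F8 = (λ ()) , const (∉NG-of-adjacent (Wing.q~x (Triangle.sep₃₁ T)) (inNG₁ (rotate (rotate T))))

      H5-of-triangle : Triangle Wing → ContainsH5 G
      H5-of-triangle T =
        h5Map T , realises⇒injective E h5Pattern (h5Map-realises T) h5-twinFree , h5Map-realises T , h5Map-probes T

  -- The bipartite graph G^φ_B

  module _ (φ : Fin n → Fin n) where

    private
      V = NSide G φ ⊎ ASide G φ
      _⋯_ = BEdge G φ
    open NSide using (vert)

    record Separator (y y′ y″ : NSide G φ) : Set where
      field
        a    : ASide G φ
        y~a  : ABAdj G φ y a
        y′~a : ABAdj G φ y′ a
        y″≁a : ¬ ABAdj G φ y″ a

      private
        ≢y″ : ∀ u → ABAdj G φ u a → vert u ≢ vert y″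
        ≢y″ _ (K , S , P , u∈S) u≡y″ = y″≁a (K , S , P , subst (_∈ S) u≡y″ u∈S)

      y≢y″ : vert y ≢ vert y″
      y≢y″ = ≢y″ y y~a

      y′≢y″ : vert y′ ≢ vert y″
      y′≢y″ = ≢y″ y′ y′~a

    BEdge-sym : ∀ {u v} → BEdge G φ u v → BEdge G φ v u
    BEdge-sym {inj₁ _} {inj₂ _} e = e
    BEdge-sym {inj₂ _} {inj₁ _} e = e

    BEdge-irr : ∀ {v} → ¬ BEdge G φ v v
    BEdge-irr {inj₁ _} ()
    BEdge-irr {inj₂ _} ()

    C6-of-triangle : Triangle Separator → InducedC6 (GB G φ)
    C6-of-triangle T = g , realises⇒injective (BEdge G φ) cyclePattern realises cycle-twinFree , realises
      where
        open Triangle T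
        open Separator
        g : Fin 6 → V
        g F0 = inj₁ x₁
        g F1 = inj₂ (a sep₁₂)
        g F2 = inj₁ x₂
        g F3 = inj₂ (a sep₂₃)
        g F4 = inj₁ x₃
        g F5 = inj₂ (a sep₃₁)
        realises : Realises (BEdge G φ) cyclePattern g
        realises = realises-from-upperFacts (BEdge G φ) cyclePattern BEdge-sym BEdge-irr g
          ( y~a sep₁₂ ∷ (λ ()) ∷ y″≁a sep₂₃ ∷ (λ ()) ∷ y′~a sep₃₁
          ∷ y′~a sep₁₂ ∷ (λ ()) ∷ y″≁a sep₁₂ ∷ (λ ())
          ∷ y~a sep₂₃ ∷ (λ ()) ∷ y″≁a sep₃₁
          ∷ y′~a sep₂₃ ∷ (λ ())
          ∷ y~a sep₃₁ ∷ [])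

    triangle-from : (y₁ : NSide G φ) (v₁ v₂ v₃ v₄ v₅ : V) →
                    inj₁ y₁ ⋯ v₁ → v₁ ⋯ v₂ → v₂ ⋯ v₃ → v₃ ⋯ v₄ → v₄ ⋯ v₅ → v₅ ⋯ inj₁ y₁ →
                    ¬ inj₁ y₁ ⋯ v₃ → ¬ v₁ ⋯ v₄ → ¬ v₂ ⋯ v₅ → Triangle Separator
    triangle-from y₁ (inj₂ a₁₂) (inj₁ y₂) (inj₂ a₂₃) (inj₁ y₃) (inj₂ a₃₁) e₀₁ e₁₂ e₂₃ e₃₄ e₄₅ e₅₀ n₀₃ n₁₄ n₂₅ =
      record
        { x₁ = y₁ ; x₂ = y₂ ; x₃ = y₃
        ; sep₁₂ = record { a = a₁₂ ; y~a = e₀₁ ; y′~a = e₁₂ ; y″≁a = n₁₄ }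
        ; sep₂₃ = record { a = a₂₃ ; y~a = e₂₃ ; y′~a = e₃₄ ; y″≁a = n₀₃ }
        ; sep₃₁ = record { a = a₃₁ ; y~a = e₄₅ ; y′~a = e₅₀ ; y″≁a = n₂₅ }
        }
    triangle-from _ (inj₁ _) _ _ _ _ () _ _ _ _ _ _ _ _
    triangle-from _ (inj₂ _) (inj₂ _) _ _ _ _ () _ _ _ _ _ _ _
    triangle-from _ (inj₂ _) (inj₁ _) (inj₁ _) _ _ _ _ () _ _ _ _ _ _
    triangle-from _ (inj₂ _) (inj₁ _) (inj₂ _) (inj₂ _) _ _ _ _ () _ _ _ _ _
    triangle-from _ (inj₂ _) (inj₁ _) (inj₂ _) (inj₁ _) (inj₁ _) _ _ _ _ () _ _ _ _

    triangle-of-hexagon : (v₀ v₁ v₂ v₃ v₄ v₅ : V) →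
                          v₀ ⋯ v₁ → v₁ ⋯ v₂ → v₂ ⋯ v₃ → v₃ ⋯ v₄ → v₄ ⋯ v₅ → v₅ ⋯ v₀ →
                          ¬ v₀ ⋯ v₃ → ¬ v₁ ⋯ v₄ → ¬ v₂ ⋯ v₅ → Triangle Separator
    triangle-of-hexagon (inj₁ y) v₁ v₂ v₃ v₄ v₅ = triangle-from y v₁ v₂ v₃ v₄ v₅
    triangle-of-hexagon (inj₂ a) (inj₁ y) v₂ v₃ v₄ v₅ e₀₁ e₁₂ e₂₃ e₃₄ e₄₅ e₅₀ n₀₃ n₁₄ n₂₅ =
      triangle-from y v₂ v₃ v₄ v₅ (inj₂ a) e₁₂ e₂₃ e₃₄ e₄₅ e₅₀ e₀₁ n₁₄ n₂₅ (n₀₃ ∘ BEdge-sym)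
    triangle-of-hexagon (inj₂ _) (inj₂ _) _ _ _ _ ()

    triangle-of-C6 : InducedC6 (GB G φ) → Triangle Separator
    triangle-of-C6 (f , _ , realises) = triangle-of-hexagon (f F0) (f F1) (f F2) (f F3) (f F4) (f F5)
      (adj F0 F1) (adj F1 F2) (adj F2 F3) (adj F3 F4) (adj F4 F5) (adj F5 F0)
      (nonadj F0 F3) (nonadj F1 F4) (nonadj F2 F5)
      where
        adj    = realised-edge (BEdge G φ) cyclePattern realises
        nonadj = realised-non-edge (BEdge G φ) cyclePattern realises

    module _ (lucs : LUCS G) where

      nside : Triangle Wing → NSide G φ
      nside T = nv (Triangle.x₁ T) (inNG₁ lucs T)

      module _ (cof : CoP3K2Free G) (φ-injective : Injective _≡_ _≡_ φ) where

        separator : (T : Triangle Wing) → Separator (nside T) (nside (rotate T)) (nside (rotate (rotate T)))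
        separator T with minimiser φ (wingEnd? x₁ x₂ x₃) (p , p~x , p~y , p≁z , q , p~q , q~x , q~y)
          where
            open Triangle T
            open Wing sep₁₂
        ... | m , (m~x₁ , m~x₂ , m≁x₃ , b , m~b , b~x₁ , b~x₂) , minimal = record
          { a    = av m C (component , K , S , partition , two≤∣S∣ x∈S y∈S (proj₁ (nonEdge₁₂ T)) , K-after-m)
          ; y~a  = K , S , partition , x∈S
          ; y′~a = K , S , partition , y∈S
          ; y″≁a = λ (_ , _ , P , x₃∈S) → m≁x₃ (component-⊆N component (S⊆C P x₃∈S))
          }
          where
            open Triangle T
            mb : EdgeOver x₁ x₂
            mb = record { p = m ; q = b ; p~q = m~b ; p~x = m~x₁ ; p~y = m~x₂ ; q~x = b~x₁ ; q~y = b~x₂ }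
            open StableAt (stableAt lucs mb (nonEdge₁₂ T))
            K-after-m : ∀ v → v ∈ K → φ m Fin.< φ v
            K-after-m v v∈K = Fin.≤∧≢⇒< (minimal v v-end) (m≢v ∘ φ-injective)
              where
                m~v  = component-⊆N component (K⊆C partition v∈K)
                v~x₁ = K~S partition v∈K x∈S
                v~x₂ = K~S partition v∈K y∈S
                v≁x₃ : ¬ E v x₃
                v≁x₃ v~x₃ = m≁x₃ (localTwins lucs cof (swap (Wing.edge sep₃₁)) (nonEdge₁₃ T)
                                   v~x₁ v~x₃ (E-sym m~v) m~x₁)
                v-end = v~x₁ , v~x₂ , v≁x₃ , m , E-sym m~v , m~x₁ , m~x₂
                m≢v : m ≢ v
                m≢v refl = E-irr m~v

    nonadjacent : NGIndependent G → (y y′ : NSide G φ) → ¬ E (vert y) (vert y′)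
    nonadjacent ngi (nv x x∈N) (nv x′ x′∈N) = recompute (¬? (E-dec x x′)) (ngi x x′ x∈N x′∈N)

    centre-adjacent : (a : ASide G φ) → ∀ {x} → x ∈ ASide.comp a → E (ASide.centre a) x
    centre-adjacent (av c _ valid) x∈C = recompute (E-dec c _) (component-⊆N (proj₁ valid) x∈C)

    comp-closed : (a : ASide G φ) → ∀ {x y} →
                  x ∈ ASide.comp a → E (ASide.centre a) y → E x y → y ∈ ASide.comp a
    comp-closed (av _ C valid) x∈C c~y x~y =
      recompute (_ ∈? C) (component-closed (proj₁ valid) x∈C c~y x~y)

    comp-step : (a : ASide G φ) → ∀ {x y} →
                x ∈ ASide.comp a → y ∈ ASide.comp a → x ≢ y → ∃[ t ] t ∈ ASide.comp a × E x t
    comp-step (av _ C valid) x∈C y∈C x≢y = recompute (Fin.any? λ t → (t ∈? C) ×-dec E-dec _ t)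
      (Reach⇒step x≢y (component-connected (proj₁ valid) x∈C y∈C))

    module _ (a : ASide G φ) where
      open ASide a

      spoke : (y₁ y₂ : NSide G φ) → ABAdj G φ y₁ a → ABAdj G φ y₂ a → NonEdge (vert y₁) (vert y₂) →
              Σ[ e ∈ EdgeOver (vert y₁) (vert y₂) ]
                (∀ y → E (EdgeOver.p e) (vert y) → E (EdgeOver.q e) (vert y) → ¬ E (vert y) (vert y₁) →
                   ABAdj G φ y a)
      spoke y₁ y₂ (K , S , P , x₁∈S) (_ , _ , P′ , x₂∈S′) (x₁≢x₂ , x₁≁x₂)
        with comp-step a (S⊆C P x₁∈S) (S⊆C P′ x₂∈S′) x₁≢x₂
      ... | t , t∈C , x₁~t = record
          { p = centre ; q = t ; p~q = centre-adjacent a t∈C ; p~x = centre-adjacent a x₁∈C ; p~y = centre-adjacent a x₂∈C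
          ; q~x = E-sym x₁~t ; q~y = K~S P t∈K x₂∈S }
        , joined
        where
          x₁∈C = S⊆C P x₁∈S
          x₂∈C = S⊆C P′ x₂∈S′
          t∈K  = ∈K-of-adjacent P t∈C x₁∈S x₁~t
          x₂∈S = ∈S-of-nonadjacent P x₂∈C x₁∈S (x₁≁x₂ ∘ E-sym)
          joined : ∀ y → E centre (vert y) → E t (vert y) → ¬ E (vert y) (vert y₁) → ABAdj G φ y a
          joined y c~y t~y y≁x₁ = K , S , P , ∈S-of-nonadjacent P (comp-closed a t∈C c~y t~y) x₁∈S y≁x₁

    module _ (lucs : LUCS G) (cof : CoP3K2Free G) (ngi : NGIndependent G) where

      wing : (T : Triangle Separator) →
             Wing (vert (Triangle.x₁ T)) (vert (Triangle.x₂ T)) (vert (Triangle.x₃ T))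
      wing T = record
        { x≁y = nonadjacent ngi y₁ y₂ ; p = p ; q = q ; p~q = p~q
        ; p~x = p~x ; p~y = p~y ; q~x = q~x ; q~y = q~y
        ; p≁z = λ p~x₃ → y₃≁a (joined y₃ p~x₃ (twins p~x p~x₃ p~q q~x) y₃≁y₁)
        ; q≁z = λ q~x₃ → y₃≁a (joined y₃ (twins q~x q~x₃ (E-sym p~q) p~x) q~x₃ y₃≁y₁)
        }
        where
          open Triangle T renaming (x₁ to y₁ ; x₂ to y₂ ; x₃ to y₃)
          open Separator
          y₁y₂ = y′≢y″ sep₃₁ , nonadjacent ngi y₁ y₂
          y₁y₃ = y≢y″ sep₁₂ , nonadjacent ngi y₁ y₃
          spoke₁₂ = spoke (a sep₁₂) y₁ y₂ (y~a sep₁₂) (y′~a sep₁₂) y₁y₂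
          spoke₃₁ = spoke (a sep₃₁) y₃ y₁ (y~a sep₃₁) (y′~a sep₃₁) (NonEdge-sym y₁y₃)
          open EdgeOver (proj₁ spoke₁₂)
          joined = proj₂ spoke₁₂
          twins : ∀ {w} → E w (vert y₁) → E w (vert y₃) → LocalTwins w (vert y₁) (vert y₃)
          twins = localTwins lucs cof (swap (proj₁ spoke₃₁)) y₁y₃
          y₃≁a  = y″≁a sep₁₂
          y₃≁y₁ = nonadjacent ngi y₃ y₁

lemma7 : ∀ (n : ℕ) (G : SimpleGraph n) →
    LUCS G → CoP3K2Free G → NGIndependent G →
    ∀ (φ : Fin n → Fin n) → Bijective _≡_ _≡_ φ →
    (ContainsH5 G ⇔ InducedC6 (GB G φ))
lemma7 n G lucs cof ngi φ (φ-injective , _) = mk⇔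
  (C6-of-triangle G φ ∘ mapTriangle (nside G φ lucs) (separator G φ lucs cof φ-injective) ∘ triangle-of-H5 G)
  (H5-of-triangle G lucs ngi ∘ mapTriangle (NSide.vert ∘ Triangle.x₁) (wing G φ lucs cof ngi) ∘ triangle-of-C6 G φ)
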